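{- Let $\mathcal G=(V,\mathcal E)$ be a temporal digraph. Then the digraphs $\mathrm{Reach}(\mathcal G)$ and $\mathcal G_\downarrow$ have the same strongly connected components.
   Context: A temporal digraph is a pair $\mathcal G=(V,\mathcal E)$ where $\mathcal E$ is a finite set of (distinct) temporal arcs $((u,v),t)$ with $u\neq v\in V$ and $t$ a positive integer. A journey from $u_0$ to $u_k$ is a sequence $(u_0,u_1,t_0),\dots,(u_{k-1},u_k,t_{k-1})$ with each $((u_i,u_{i+1}),t_i)\in\mathcal E$ and $t_0<\dots<t_{k-1}$. The footprint $\mathcal G_\downarrow$ is the static digraph on $V$ with arc set $\{(u,v) : ((u,v),t)\in\mathcal E \text{ for some } t\}$. The reachability graph $\mathrm{Reach}(\mathcal G)$ is the digraph on $V$ containing the arc $(u,v)$ iff there is a journey from $u$ to $v$ in $\mathcal G$. -}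

module Defs where

open import Data.Nat using (ℕ; _<_)
open import Data.Fin using (Fin)
open import Data.List using (List)
open import Data.List.Membership.Propositional using (_∈_)
open import Data.List.Relation.Unary.All using (All)
open import Data.List.Relation.Unary.Unique.Propositional using (Unique)
open import Data.Product using (Σ; ∃; _×_; _,_)
open import Relation.Binary.PropositionalEquality using (_≡_; _≢_)
open import Relation.Binary.Construct.Closure.ReflexiveTransitive using (Star)
open import Function.Bundles using (_⇔_)

record TArc (n : ℕ) : Set where
  constructor tarc
  field
    src  : Fin n
    tgt  : Fin n
    time : ℕ
open TArc public

record TemporalDigraph (n : ℕ) : Set where
  field
    arcs     : List (TArc n)
    distinct : Unique arcs
    loopless : All (λ a → src a ≢ tgt a) arcs
    positive : All (λ a → 0 < time a) arcs
open TemporalDigraph public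

Digraph : ℕ → Set₁
Digraph n = Fin n → Fin n → Set

-- JourneyFrom G t u w : a journey from u to w whose first arc has time label t;
-- subsequent arcs have strictly increasing time labels. (Journeys have ≥ 1 arc.)
data JourneyFrom {n : ℕ} (G : TemporalDigraph n) : ℕ → Fin n → Fin n → Set where
  single : ∀ {u v t} → tarc u v t ∈ arcs G → JourneyFrom G t u v
  cons   : ∀ {u v w t t'} → tarc u v t ∈ arcs G → t < t' →
           JourneyFrom G t' v w → JourneyFrom G t u w

Journey : ∀ {n} → TemporalDigraph n → Fin n → Fin n → Set
Journey G u v = ∃ λ t → JourneyFrom G t u v

Reach : ∀ {n} → TemporalDigraph n → Digraph n
Reach G u v = Journey G u v

Footprint : ∀ {n} → TemporalDigraph n → Digraph n
Footprint G u v = ∃ λ t → tarc u v t ∈ arcs G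

Path : ∀ {n} → Digraph n → Fin n → Fin n → Set
Path D = Star D

SameSCC : ∀ {n} → Digraph n → Fin n → Fin n → Set
SameSCC D u v = Path D u v × Path D v u

{-# OPTIONS --safe #-}
module Submission where

-- A footprint arc is a one-arc journey and a journey traverses footprint arcs, so
-- Reach G and the footprint have the same reflexive–transitive closure.

open import Defs
open import Data.Nat using (ℕ)
open import Data.Fin using (Fin)
open import Data.Product using (_,_)
open import Function.Bundles using (_⇔_; mk⇔)
open import Relation.Binary.Core using (_⇒_)
open import Relation.Binary.Construct.Closure.ReflexiveTransitive using (ε; _◅_; _⋆)

sameSCC-⇔ : ∀ {n} {D E : Digraph n} → D ⇒ Path E → E ⇒ Path D →
            ∀ {u v} → SameSCC D u v ⇔ SameSCC E u v
sameSCC-⇔ D⇒E* E⇒D* = mk⇔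
  (λ (p , q) → (D⇒E* ⋆) p , (D⇒E* ⋆) q)
  (λ (p , q) → (E⇒D* ⋆) p , (E⇒D* ⋆) q)

module _ {n} {G : TemporalDigraph n} where

  footprint⇒reach : Footprint G ⇒ Reach G
  footprint⇒reach (t , uv∈G) = t , single uv∈G

  journeyFrom⇒footprintPath : ∀ {t u v} → JourneyFrom G t u v → Path (Footprint G) u v
  journeyFrom⇒footprintPath (single uv∈G)   = (_ , uv∈G) ◅ ε
  journeyFrom⇒footprintPath (cons uv∈G _ j) = (_ , uv∈G) ◅ journeyFrom⇒footprintPath j

  reach⇒footprintPath : Reach G ⇒ Path (Footprint G)
  reach⇒footprintPath (_ , j) = journeyFrom⇒footprintPath j

lemma3p3 : {n : ℕ} (G : TemporalDigraph n) (u v : Fin n) →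
    SameSCC (Reach G) u v ⇔ SameSCC (Footprint G) u v
lemma3p3 G u v = sameSCC-⇔ reach⇒footprintPath (λ uv → footprint⇒reach uv ◅ ε)
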